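{- Let $P$ be a finite set of nonempty Cayley permutations. There exists a finite set $Q \subset \mathcal{I} \cap \mathcal{P}$ such that $\mathcal{I}(P) = \mathcal{I}(Q)$.
   Context: An inversion sequence of length $n$ is an integer sequence $\sigma=(\sigma_1,\dots,\sigma_n)$ with $\sigma_i\in\{0,\dots,i-1\}$ for all $i$; $\mathcal I$ is the set of all inversion sequences (of all lengths $n\ge0$). A Cayley permutation is an integer sequence whose set of values is exactly $\{0,\dots,m\}$ for its maximum $m$; $\mathcal P$ is the set of all Cayley permutations. For integer sequences $\sigma$ and $\rho$ with $1\le|\rho|\le|\sigma|$, $\sigma$ contains $\rho$ if some subsequence of $|\rho|$ entries of $\sigma$ has its values in the same relative order as $\rho$; otherwise $\sigma$ avoids $\rho$. For a set $S$ of integer sequences, $\mathcal I(S)$ denotes the set of inversion sequences avoiding every element of $S$. -}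

module Defs where

open import Data.Nat using (ℕ; _≤_; _<_; _⊔_)
open import Data.Fin using (Fin; toℕ; cast)
open import Data.List using (List; []; length; lookup; foldr)
open import Data.List.Membership.Propositional using (_∈_)
open import Data.List.Relation.Binary.Sublist.Propositional using (_⊆_)
open import Data.List.Relation.Unary.All using (All)
open import Data.Product using (Σ; ∃-syntax; _×_)
open import Function.Bundles using (_⇔_)
open import Relation.Binary.PropositionalEquality using (_≡_; _≢_)
open import Relation.Nullary using (¬_)

-- Integer sequences: all sequences here have nonnegative entries
-- (inversion sequences and Cayley permutations), so we use List ℕ.
Seq : Set
Seq = List ℕ

-- Inversion sequence: σ_i ∈ {0,…,i-1} (1-indexed); 0-indexed position j
-- has entry ≤ j.
IsInvSeq : Seq → Set
IsInvSeq σ = (j : Fin (length σ)) → lookup σ j ≤ toℕ j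

-- maximum entry of a sequence (only meaningful for nonempty sequences)
maxEntry : Seq → ℕ
maxEntry = foldr _⊔_ 0

-- Cayley permutation: the set of values is exactly {0,…,m} with m the maximum.
-- (The maximum only exists for a nonempty sequence.)
IsCayley : Seq → Set
IsCayley σ = σ ≢ [] × ((k : ℕ) → (k ∈ σ) ⇔ (k ≤ maxEntry σ))

OrderIso : Seq → Seq → Set
OrderIso τ ρ = Σ (length τ ≡ length ρ) λ eq →
  (i j : Fin (length τ)) →
    (lookup τ i ≤ lookup τ j) ⇔ (lookup ρ (cast eq i) ≤ lookup ρ (cast eq j))

Contains : Seq → Seq → Set
Contains σ ρ = ρ ≢ [] × ∃[ τ ] (τ ⊆ σ × OrderIso τ ρ)

Avoids : Seq → Seq → Set
Avoids σ ρ = ¬ Contains σ ρ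

AvoidsAll : List Seq → Seq → Set
AvoidsAll S σ = All (Avoids σ) S

-- If the inversion sequence σ contains p, mark one occurrence A of p in σ and delete unmarked
-- entries one at a time, keeping the remaining subsequence V order-isomorphic to an inversion
-- sequence (its standardization is one).  An unmarked entry whose value occurs nowhere else in V
-- can always be deleted, and so can the last unmarked entry if every later entry has rank below
-- its position.  When neither applies, every value outside A occurs at least twice in V, so V has
-- at most (|V| + |A|)/2 distinct values, while some entry after the last unmarked one has rank at
-- least its position; together these force |V| ≤ 3|p|.  The standardization of V is then a Cayley
-- inversion sequence of length ≤ 3|p| lying between p and σ, so Q can be taken to be the finitely
-- many such sequences that contain some pattern of P.

module Submission where

open import Defs
open import Data.Nat using (ℕ; zero; suc; _+_; _*_; _≤_; _<_; _≟_; _≤?_; _<?_; z≤n; s≤s; s≤s⁻¹)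
open import Data.Nat.Properties
open import Data.Nat.Tactic.RingSolver using (solve-∀)
open import Algebra.Properties.CommutativeSemigroup +-commutativeSemigroup using (interchange)
open import Data.Bool using (Bool; true; false)
import Data.Bool.Properties as Bool
open import Data.Fin as Fin using (Fin; toℕ; cast; fromℕ<)
open import Data.Fin.Properties using (toℕ<n; toℕ-fromℕ<; cast-trans)
import Data.Fin.Properties as Fin
open import Data.List using (List; []; _∷_; [_]; _++_; length; lookup; map; zip; filter; concatMap; upTo)
open import Data.Nat.ListAction using (sum)
open import Data.List.Properties using (map-++; map-∘; map-id; length-map; length-++; length-++-sucʳ; ≡-dec)
open import Data.List.Membership.Propositional using (_∈_; _∉_; find)
open import Data.List.Membership.Propositional.Properties
  using (∈-map⁺; ∈-map⁻; ∈-++⁺ˡ; ∈-++⁺ʳ; ∈-++⁻; ∈-∃++; ∈-lookup; ∈-filter⁺; ∈-concatMap⁺; ∈-upTo⁺)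
open import Data.List.Membership.DecPropositional _≟_ using (_∈?_)
open import Data.List.Relation.Binary.Subset.Propositional using () renaming (_⊆_ to _⊑_)
open import Data.List.Relation.Unary.Any as Any using (Any; here; there; any?)
open import Data.List.Relation.Unary.Any.Properties using (lookup-index)
open import Data.List.Relation.Unary.All as All using (All; []; _∷_)
open import Data.List.Relation.Unary.All.Properties using (all-filter; All¬⇒¬Any; ¬Any⇒All¬)
open import Data.List.Relation.Binary.Sublist.Propositional using (_⊆_; []; _∷_; _∷ʳ_; ⊆-refl; ⊆-reflexive; ⊆-trans)
open import Data.List.Relation.Binary.Sublist.Propositional.Properties using (Any-resp-⊆; ++⁺)
import Data.List.Relation.Binary.Sublist.Propositional.Properties as Sublist
import Data.List.Relation.Binary.Sublist.Heterogeneous as Hetero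
import Data.List.Relation.Binary.Sublist.Heterogeneous.Properties as Hetero
open import Data.Product using (∃-syntax; ∃₂; _×_; _,_; proj₁; proj₂)
open import Data.Sum using (_⊎_; inj₁; inj₂)
import Data.Sum as Sum
open import Data.Unit using (⊤; tt)
open import Function using (_∘_; id)
open import Function.Bundles using (_⇔_; mk⇔; Equivalence)
open import Function.Construct.Composition using (_⇔-∘_)
open import Function.Construct.Symmetry using (⇔-sym)
open import Induction.WellFounded using (Acc; acc)
open import Data.Nat.Induction using (<-wellFounded)
open import Relation.Binary.Definitions using (tri<; tri≈; tri>)
open import Relation.Binary.PropositionalEquality
  using (_≡_; _≢_; refl; sym; trans; cong; cong₂; subst; subst₂; module ≡-Reasoning)
open import Relation.Nullary using (Dec; yes; no; ¬_; ¬?; _×-dec_; _→-dec_; contradiction)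
import Relation.Nullary.Decidable as Dec

-- Sums and multiplicities

sumBelow : (ℕ → ℕ) → ℕ → ℕ
sumBelow f zero = 0
sumBelow f (suc n) = sumBelow f n + f n

module _ {f : ℕ → ℕ} where

  sumBelow-monoʳ-≤ : ∀ {m n} → m ≤ n → sumBelow f m ≤ sumBelow f n
  sumBelow-monoʳ-≤ {n = zero} z≤n = ≤-refl
  sumBelow-monoʳ-≤ {m} {suc n} m≤1+n with m≤n⇒m<n∨m≡n m≤1+n
  ... | inj₁ m<1+n = ≤-trans (sumBelow-monoʳ-≤ (s≤s⁻¹ m<1+n)) (m≤m+n (sumBelow f n) (f n))
  ... | inj₂ refl = ≤-refl

  sumBelow≤n : (∀ m → f m ≤ 1) → ∀ n → sumBelow f n ≤ n
  sumBelow≤n f≤1 zero = z≤n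
  sumBelow≤n f≤1 (suc n) =
    ≤-trans (+-mono-≤ (sumBelow≤n f≤1 n) (f≤1 n)) (≤-reflexive (+-comm n 1))

  sumBelow-vanishing : ∀ {n} → (∀ m → m < n → f m ≡ 0) → sumBelow f n ≡ 0
  sumBelow-vanishing {zero} f≡0 = refl
  sumBelow-vanishing {suc n} f≡0 =
    cong₂ _+_ (sumBelow-vanishing (λ m m<n → f≡0 m (m<n⇒m<1+n m<n))) (f≡0 n ≤-refl)

  sumBelow-concentrated : ∀ {x} → (∀ m → m ≢ x → f m ≡ 0) → ∀ n → sumBelow f n ≤ f x
  sumBelow-concentrated f≡0 zero = z≤n
  sumBelow-concentrated {x} f≡0 (suc n) with n ≟ x
  ... | yes refl = ≤-reflexive (cong (_+ f n) (sumBelow-vanishing (λ m m<n → f≡0 m (<⇒≢ m<n))))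
  ... | no n≢x = begin
    sumBelow f n + f n ≡⟨ cong (sumBelow f n +_) (f≡0 n n≢x) ⟩
    sumBelow f n + 0   ≡⟨ +-identityʳ _ ⟩
    sumBelow f n       ≤⟨ sumBelow-concentrated f≡0 n ⟩
    f x                ∎
    where open ≤-Reasoning

module _ {f g : ℕ → ℕ} where

  sumBelow-+ : ∀ n → sumBelow (λ m → f m + g m) n ≡ sumBelow f n + sumBelow g n
  sumBelow-+ zero = refl
  sumBelow-+ (suc n) = begin
    sumBelow (λ m → f m + g m) n + (f n + g n)     ≡⟨ cong (_+ (f n + g n)) (sumBelow-+ n) ⟩
    (sumBelow f n + sumBelow g n) + (f n + g n)    ≡⟨ interchange (sumBelow f n) (sumBelow g n) (f n) (g n) ⟩
    (sumBelow f n + f n) + (sumBelow g n + g n)    ∎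
    where open ≡-Reasoning

  sumBelow-monoˡ-≤ : (∀ m → f m ≤ g m) → ∀ n → sumBelow f n ≤ sumBelow g n
  sumBelow-monoˡ-≤ f≤g zero = z≤n
  sumBelow-monoˡ-≤ f≤g (suc n) = +-mono-≤ (sumBelow-monoˡ-≤ f≤g n) (f≤g n)

  sumBelow-monoˡ-< : (∀ m → f m ≤ g m) → ∀ {w n} → f w < g w → w < n → sumBelow f n < sumBelow g n
  sumBelow-monoˡ-< f≤g {w} {suc n} fw<gw w<1+n with m≤n⇒m<n∨m≡n (s≤s⁻¹ w<1+n)
  ... | inj₁ w<n = +-mono-<-≤ (sumBelow-monoˡ-< f≤g fw<gw w<n) (f≤g n)
  ... | inj₂ refl = +-mono-≤-< (sumBelow-monoˡ-≤ f≤g w) fw<gw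

present : ℕ → List ℕ → ℕ
present m l with m ∈? l
... | yes _ = 1
... | no _ = 0

present-∈ : ∀ {m l} → m ∈ l → present m l ≡ 1
present-∈ {m} {l} m∈l with m ∈? l
... | yes _ = refl
... | no m∉l = contradiction m∈l m∉l

present-∉ : ∀ {m l} → m ∉ l → present m l ≡ 0
present-∉ {m} {l} m∉l with m ∈? l
... | yes m∈l = contradiction m∈l m∉l
... | no _ = refl

present-≤1 : ∀ m l → present m l ≤ 1
present-≤1 m l with m ∈? l
... | yes _ = ≤-refl
... | no _ = z≤n

present-mono : ∀ {a b} → a ⊑ b → ∀ m → present m a ≤ present m b
present-mono {a} {b} a⊑b m with m ∈? a
... | yes m∈a = ≤-reflexive (sym (present-∈ (a⊑b m∈a)))
... | no _ = z≤n

multiplicity : ℕ → List ℕ → ℕ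
multiplicity m [] = 0
multiplicity m (x ∷ l) with m ≟ x
... | yes _ = suc (multiplicity m l)
... | no _ = multiplicity m l

multiplicity-++ : ∀ m a b → multiplicity m (a ++ b) ≡ multiplicity m a + multiplicity m b
multiplicity-++ m [] b = refl
multiplicity-++ m (x ∷ a) b with m ≟ x
... | yes _ = cong suc (multiplicity-++ m a b)
... | no _ = multiplicity-++ m a b

multiplicity-insert : ∀ m a c → multiplicity m (a ++ m ∷ c) ≡ suc (multiplicity m (a ++ c))
multiplicity-insert m a c = begin
  multiplicity m (a ++ m ∷ c)              ≡⟨ multiplicity-++ m a (m ∷ c) ⟩
  multiplicity m a + multiplicity m (m ∷ c) ≡⟨ cong (multiplicity m a +_) (self c) ⟩
  multiplicity m a + suc (multiplicity m c) ≡⟨ +-suc (multiplicity m a) (multiplicity m c) ⟩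
  suc (multiplicity m a + multiplicity m c) ≡⟨ cong suc (multiplicity-++ m a c) ⟨
  suc (multiplicity m (a ++ c))            ∎
  where
  open ≡-Reasoning
  self : ∀ l → multiplicity m (m ∷ l) ≡ suc (multiplicity m l)
  self l with m ≟ m
  ... | yes _ = refl
  ... | no m≢m = contradiction refl m≢m

∈⇒multiplicity-pos : ∀ {m l} → m ∈ l → 1 ≤ multiplicity m l
∈⇒multiplicity-pos {m} m∈l with ∈-∃++ m∈l
... | a , c , refl = subst (1 ≤_) (sym (multiplicity-insert m a c)) (s≤s z≤n)

present≤multiplicity : ∀ m l → present m l ≤ multiplicity m l
present≤multiplicity m l with m ∈? l
... | yes m∈l = ∈⇒multiplicity-pos m∈l
... | no _ = z≤n

sumBelow-multiplicity-≤ : ∀ l n → sumBelow (λ m → multiplicity m l) n ≤ length l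
sumBelow-multiplicity-≤ [] n = ≤-reflexive (sumBelow-vanishing {n = n} (λ _ _ → refl))
sumBelow-multiplicity-≤ (x ∷ l) n = begin
  sumBelow (λ m → multiplicity m ([ x ] ++ l)) n
    ≤⟨ sumBelow-monoˡ-≤ (λ m → ≤-reflexive (multiplicity-++ m [ x ] l)) n ⟩
  sumBelow (λ m → multiplicity m [ x ] + multiplicity m l) n
    ≡⟨ sumBelow-+ n ⟩
  sumBelow (λ m → multiplicity m [ x ]) n + sumBelow (λ m → multiplicity m l) n
    ≤⟨ +-mono-≤ (sumBelow-concentrated elsewhere n) (sumBelow-multiplicity-≤ l n) ⟩
  multiplicity x [ x ] + length l
    ≡⟨ cong (_+ length l) (multiplicity-insert x [] []) ⟩
  suc (length l) ∎
  where
  open ≤-Reasoning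
  elsewhere : ∀ m → m ≢ x → multiplicity m [ x ] ≡ 0
  elsewhere m m≢x with m ≟ x
  ... | yes m≡x = contradiction m≡x m≢x
  ... | no _ = refl

-- Ranks and standardization

rank : List ℕ → ℕ → ℕ
rank τ = sumBelow (λ m → present m τ)

standardize : List ℕ → List ℕ
standardize τ = map (rank τ) τ

module _ (τ : List ℕ) where

  rank-mono : ∀ {u v} → u ≤ v → rank τ u ≤ rank τ v
  rank-mono = sumBelow-monoʳ-≤

  rank-suc-∈ : ∀ {v} → v ∈ τ → rank τ (suc v) ≡ suc (rank τ v)
  rank-suc-∈ {v} v∈τ = trans (cong (rank τ v +_) (present-∈ v∈τ)) (+-comm (rank τ v) 1)

  rank-< : ∀ {u v} → u ∈ τ → u < v → rank τ u < rank τ v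
  rank-< u∈τ u<v = ≤-trans (≤-reflexive (sym (rank-suc-∈ u∈τ))) (rank-mono u<v)

  rank-≤ : ∀ v → rank τ v ≤ v
  rank-≤ = sumBelow≤n (λ m → present-≤1 m τ)

  rank-order : ∀ {x y} → x ∈ τ → y ∈ τ → (x ≤ y) ⇔ (rank τ x ≤ rank τ y)
  rank-order {x} {y} x∈τ y∈τ = mk⇔ rank-mono reflect
    where
    reflect : rank τ x ≤ rank τ y → x ≤ y
    reflect rx≤ry with x ≤? y
    ... | yes x≤y = x≤y
    ... | no x≰y = contradiction rx≤ry (<⇒≱ (rank-< y∈τ (≰⇒> x≰y)))

  rank-surjective : ∀ {k} v → k < rank τ v → ∃[ x ] (x ∈ τ × rank τ x ≡ k)
  rank-surjective {k} (suc v) k<r with v ∈? τ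
  ... | no _ = rank-surjective v (subst (k <_) (+-identityʳ (rank τ v)) k<r)
  ... | yes v∈τ with m<1+n⇒m<n∨m≡n (subst (k <_) (+-comm (rank τ v) 1) k<r)
  ...   | inj₁ k<r′ = rank-surjective v k<r′
  ...   | inj₂ refl = v , v∈τ , refl

module _ {a b : List ℕ} (a⊑b : a ⊑ b) where

  rank-⊑ : ∀ v → rank a v ≤ rank b v
  rank-⊑ = sumBelow-monoˡ-≤ (present-mono a⊑b)

  rank-⊏ : ∀ {w v} → w ∈ b → w ∉ a → w < v → rank a v < rank b v
  rank-⊏ w∈b w∉a = sumBelow-monoˡ-< (present-mono a⊑b)
    (subst₂ _<_ (sym (present-∉ w∉a)) (sym (present-∈ w∈b)) (s≤s z≤n))

twice-rank-≤ : ∀ V A → (∀ m → m ∈ V → m ∉ A → 2 ≤ multiplicity m V) →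
  ∀ n → rank V n + rank V n ≤ length V + length A
twice-rank-≤ V A repeated n = begin
  rank V n + rank V n
    ≡⟨ sumBelow-+ n ⟨
  sumBelow (λ m → present m V + present m V) n
    ≤⟨ sumBelow-monoˡ-≤ pointwise n ⟩
  sumBelow (λ m → multiplicity m V + present m A) n
    ≡⟨ sumBelow-+ n ⟩
  sumBelow (λ m → multiplicity m V) n + rank A n
    ≤⟨ +-mono-≤ (sumBelow-multiplicity-≤ V n)
               (≤-trans (sumBelow-monoˡ-≤ (λ m → present≤multiplicity m A) n) (sumBelow-multiplicity-≤ A n)) ⟩
  length V + length A ∎
  where
  open ≤-Reasoning
  pointwise : ∀ m → present m V + present m V ≤ multiplicity m V + present m A
  pointwise m with m ∈? V | m ∈? A
  ... | no _ | _ = z≤n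
  ... | yes m∈V | yes _ = subst (2 ≤_) (+-comm 1 (multiplicity m V)) (s≤s (∈⇒multiplicity-pos m∈V))
  ... | yes m∈V | no m∉A = subst (2 ≤_) (sym (+-identityʳ (multiplicity m V))) (repeated m m∈V m∉A)

-- Cayley permutations

≤-maxEntry : ∀ {x l} → x ∈ l → x ≤ maxEntry l
≤-maxEntry {l = y ∷ l} (here refl) = m≤m⊔n y (maxEntry l)
≤-maxEntry {l = y ∷ l} (there x∈l) = ≤-trans (≤-maxEntry x∈l) (m≤n⊔m y (maxEntry l))

maxEntry-∈ : ∀ {l} → l ≢ [] → maxEntry l ∈ l
maxEntry-∈ {[]} l≢[] = contradiction refl l≢[]
maxEntry-∈ {y ∷ l} _ = go y l
  where
  go : ∀ y l → maxEntry (y ∷ l) ∈ y ∷ l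
  go y [] = here (⊔-identityʳ y)
  go y (z ∷ l) with ⊔-sel y (maxEntry (z ∷ l))
  ... | inj₁ max≡y = here max≡y
  ... | inj₂ max≡rest = there (subst (_∈ z ∷ l) (sym max≡rest) (go z l))

downClosed⇒isCayley : ∀ {q} → q ≢ [] → (∀ {x k} → x ∈ q → k ≤ x → k ∈ q) → IsCayley q
downClosed⇒isCayley q≢[] closed = q≢[] , λ k → mk⇔ ≤-maxEntry (closed (maxEntry-∈ q≢[]))

standardize-downClosed : ∀ V {x k} → x ∈ standardize V → k ≤ x → k ∈ standardize V
standardize-downClosed V x∈ k≤x with ∈-map⁻ (rank V) x∈
... | y , y∈V , refl with m≤n⇒m<n∨m≡n k≤x
...   | inj₂ refl = x∈
...   | inj₁ k<x with rank-surjective V y k<x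
...     | z , z∈V , refl = ∈-map⁺ (rank V) z∈V

standardize-isCayley : ∀ {V} → V ≢ [] → IsCayley (standardize V)
standardize-isCayley {[]} V≢[] = contradiction refl V≢[]
standardize-isCayley {V@(_ ∷ _)} _ = downClosed⇒isCayley (λ ()) (standardize-downClosed V)

isCayley? : ∀ q → Dec (IsCayley q)
isCayley? q = Dec.map′ fromBounded toBounded (¬? (≡-dec _≟_ q []) ×-dec Fin.all? (λ i → toℕ i ∈? q))
  where
  fromBounded : q ≢ [] × (∀ (i : Fin (suc (maxEntry q))) → toℕ i ∈ q) → IsCayley q
  fromBounded (q≢[] , below) = q≢[] , λ k → mk⇔ ≤-maxEntry
    (λ k≤max → subst (_∈ q) (toℕ-fromℕ< (s≤s k≤max)) (below (fromℕ< (s≤s k≤max))))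
  toBounded : IsCayley q → q ≢ [] × (∀ (i : Fin (suc (maxEntry q))) → toℕ i ∈ q)
  toBounded (q≢[] , values) = q≢[] , λ i → Equivalence.from (values (toℕ i)) (s≤s⁻¹ (toℕ<n i))

Staircase : (ℕ → ℕ) → ℕ → List ℕ → Set
Staircase f i [] = ⊤
Staircase f i (x ∷ l) = f x ≤ i × Staircase f (suc i) l

module _ (f : ℕ → ℕ) where

  staircase-++⁻ : ∀ i a {b} → Staircase f i (a ++ b) → Staircase f i a × Staircase f (i + length a) b
  staircase-++⁻ i [] {b} s = tt , subst (λ j → Staircase f j b) (sym (+-identityʳ i)) s
  staircase-++⁻ i (x ∷ a) {b} (fx≤i , s) with staircase-++⁻ (suc i) a s
  ... | sa , sb = (fx≤i , sa) , subst (λ j → Staircase f j b) (sym (+-suc i (length a))) sb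

  staircase-++⁺ : ∀ i a {b} → Staircase f i a → Staircase f (i + length a) b → Staircase f i (a ++ b)
  staircase-++⁺ i [] {b} _ sb = subst (λ j → Staircase f j b) (+-identityʳ i) sb
  staircase-++⁺ i (x ∷ a) {b} (fx≤i , sa) sb =
    fx≤i , staircase-++⁺ (suc i) a sa (subst (λ j → Staircase f j b) (+-suc i (length a)) sb)

  staircase-or-violation : ∀ i l → Staircase f i l ⊎ ∃[ y ] (y ∈ l × i < f y)
  staircase-or-violation i [] = inj₁ tt
  staircase-or-violation i (x ∷ l) with f x ≤? i | staircase-or-violation (suc i) l
  ... | no fx≰i | _ = inj₂ (x , here refl , ≰⇒> fx≰i)
  ... | yes _ | inj₂ (y , y∈l , 1+i<fy) = inj₂ (y , there y∈l , <-trans (n<1+n i) 1+i<fy)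
  ... | yes fx≤i | inj₁ s = inj₁ (fx≤i , s)

  staircase-map : ∀ {i} l → Staircase f i l → Staircase id i (map f l)
  staircase-map [] _ = tt
  staircase-map (x ∷ l) (fx≤i , s) = fx≤i , staircase-map l s

staircase-mono : ∀ {f g i} l → (∀ x → g x ≤ f x) → Staircase f i l → Staircase g i l
staircase-mono [] g≤f _ = tt
staircase-mono (x ∷ l) g≤f (fx≤i , s) = ≤-trans (g≤f x) fx≤i , staircase-mono l g≤f s

staircase-lower : ∀ {f g i} l → (∀ {y} → y ∈ l → g y ≤ i ⊎ g y < f y) →
  Staircase f (suc i) l → Staircase g i l
staircase-lower [] _ _ = tt
staircase-lower (x ∷ l) lower (fx≤1+i , s) =
  Sum.[ id , (λ gx<fx → s≤s⁻¹ (≤-trans gx<fx fx≤1+i)) ] (lower (here refl)) ,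
  staircase-lower l (Sum.map₁ m≤n⇒m≤1+n ∘ lower ∘ there) s

staircase⇔lookup : ∀ i l → Staircase id i l ⇔ (∀ j → lookup l j ≤ i + toℕ j)
staircase⇔lookup i l = mk⇔ (to i l) (from i l)
  where
  to : ∀ i l → Staircase id i l → ∀ j → lookup l j ≤ i + toℕ j
  to i (x ∷ l) (x≤i , s) Fin.zero = subst (x ≤_) (sym (+-identityʳ i)) x≤i
  to i (x ∷ l) (x≤i , s) (Fin.suc j) = subst (lookup l j ≤_) (sym (+-suc i (toℕ j))) (to (suc i) l s j)
  from : ∀ i l → (∀ j → lookup l j ≤ i + toℕ j) → Staircase id i l
  from i [] _ = tt
  from i (x ∷ l) bound =
    subst (x ≤_) (+-identityʳ i) (bound Fin.zero) ,
    from (suc i) l (λ j → subst (lookup l j ≤_) (+-suc i (toℕ j)) (bound (Fin.suc j)))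

-- V is order-isomorphic to an inversion sequence, namely to standardize V.
InvShaped : List ℕ → Set
InvShaped V = Staircase (rank V) 0 V

isInvSeq⇒invShaped : ∀ {σ} → IsInvSeq σ → InvShaped σ
isInvSeq⇒invShaped {σ} inv = staircase-mono σ (rank-≤ σ) (Equivalence.from (staircase⇔lookup 0 σ) inv)

invShaped⇒isInvSeq : ∀ {V} → InvShaped V → IsInvSeq (standardize V)
invShaped⇒isInvSeq {V} s = Equivalence.to (staircase⇔lookup 0 (standardize V)) (staircase-map (rank V) V s)

-- Occurrences

Concordant : List (ℕ × ℕ) → Set
Concordant w = ∀ {a b} → a ∈ w → b ∈ w → (proj₁ a ≤ proj₁ b) ⇔ (proj₂ a ≤ proj₂ b)

-- An occurrence of ρ in σ as the list of matched (σ-entry, ρ-entry) pairs; unlike Contains, this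
-- composes without index arithmetic.
Occurrence : Seq → Seq → Set
Occurrence σ ρ = ∃[ w ] (map proj₁ w ⊆ σ × map proj₂ w ≡ ρ × Concordant w)

module _ {A B : Set} where

  map-proj₁-zip : ∀ (xs : List A) (ys : List B) → length xs ≡ length ys → map proj₁ (zip xs ys) ≡ xs
  map-proj₁-zip [] [] _ = refl
  map-proj₁-zip (x ∷ xs) (y ∷ ys) eq = cong (x ∷_) (map-proj₁-zip xs ys (suc-injective eq))

  map-proj₂-zip : ∀ (xs : List A) (ys : List B) → length xs ≡ length ys → map proj₂ (zip xs ys) ≡ ys
  map-proj₂-zip [] [] _ = refl
  map-proj₂-zip (x ∷ xs) (y ∷ ys) eq = cong (y ∷_) (map-proj₂-zip xs ys (suc-injective eq))

  ∈-zip⁻ : ∀ (xs : List A) (ys : List B) (eq : length xs ≡ length ys) {p} → p ∈ zip xs ys →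
    ∃[ i ] (p ≡ (lookup xs i , lookup ys (cast eq i)))
  ∈-zip⁻ (x ∷ xs) (y ∷ ys) eq (here refl) = Fin.zero , refl
  ∈-zip⁻ (x ∷ xs) (y ∷ ys) eq (there p∈) with ∈-zip⁻ xs ys (suc-injective eq) p∈
  ... | i , refl = Fin.suc i , refl

  lookup-map : ∀ (f : A → B) xs (i : Fin (length (map f xs))) →
    lookup (map f xs) i ≡ f (lookup xs (cast (length-map f xs) i))
  lookup-map f (x ∷ xs) Fin.zero = refl
  lookup-map f (x ∷ xs) (Fin.suc i) = lookup-map f xs i

contains⇒occurrence : ∀ {σ ρ} → Contains σ ρ → Occurrence σ ρ
contains⇒occurrence {σ} {ρ} (_ , τ , τ⊆σ , eq , iso) =
  zip τ ρ ,
  subst (_⊆ σ) (sym (map-proj₁-zip τ ρ eq)) τ⊆σ ,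
  map-proj₂-zip τ ρ eq ,
  concordant
  where
  concordant : Concordant (zip τ ρ)
  concordant a∈ b∈ with ∈-zip⁻ τ ρ eq a∈ | ∈-zip⁻ τ ρ eq b∈
  ... | i , refl | j , refl = iso i j

concordant⇒orderIso : ∀ {w} → Concordant w → OrderIso (map proj₁ w) (map proj₂ w)
concordant⇒orderIso {w} concordant = eq , λ i j →
  subst₂ (λ a b → (a ≤ b) ⇔ (lookup (map proj₂ w) (cast eq i) ≤ lookup (map proj₂ w) (cast eq j)))
    (sym (lookup-map proj₁ w i)) (sym (lookup-map proj₁ w j))
    (subst₂ (λ a b → (proj₁ (entry i) ≤ proj₁ (entry j)) ⇔ (a ≤ b))
      (sym (lookup₂ i)) (sym (lookup₂ j))
      (concordant (∈-lookup (index i)) (∈-lookup (index j))))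
  where
  eq : length (map proj₁ w) ≡ length (map proj₂ w)
  eq = trans (length-map proj₁ w) (sym (length-map proj₂ w))
  index : Fin (length (map proj₁ w)) → Fin (length w)
  index = cast (length-map proj₁ w)
  entry : Fin (length (map proj₁ w)) → ℕ × ℕ
  entry i = lookup w (index i)
  lookup₂ : ∀ i → lookup (map proj₂ w) (cast eq i) ≡ proj₂ (entry i)
  lookup₂ i = trans (lookup-map proj₂ w (cast eq i))
    (cong (proj₂ ∘ lookup w) (cast-trans eq (length-map proj₂ w) i))

occurrence⇒contains : ∀ {σ ρ} → ρ ≢ [] → Occurrence σ ρ → Contains σ ρ
occurrence⇒contains ρ≢[] (w , w⊆σ , refl , concordant) =
  ρ≢[] , map proj₁ w , w⊆σ , concordant⇒orderIso concordant

-- An embedding of w₁ into w₂ sending each pair (x , _) to a pair (_ , x); splicing along it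
-- composes the two occurrences.
Matches : List (ℕ × ℕ) → List (ℕ × ℕ) → Set
Matches = Hetero.Sublist (λ b a → proj₁ b ≡ proj₂ a)

splice : ∀ {w₁ w₂} → Matches w₁ w₂ → List (ℕ × ℕ)
splice Hetero.[] = []
splice (_ Hetero.∷ʳ m) = splice m
splice {b ∷ _} {a ∷ _} (_ Hetero.∷ m) = (proj₁ a , proj₂ b) ∷ splice m

splice-proj₁ : ∀ {w₁ w₂} (m : Matches w₁ w₂) → map proj₁ (splice m) ⊆ map proj₁ w₂
splice-proj₁ Hetero.[] = []
splice-proj₁ (a Hetero.∷ʳ m) = proj₁ a ∷ʳ splice-proj₁ m
splice-proj₁ (_ Hetero.∷ m) = refl ∷ splice-proj₁ m

splice-proj₂ : ∀ {w₁ w₂} (m : Matches w₁ w₂) → map proj₂ (splice m) ≡ map proj₂ w₁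
splice-proj₂ Hetero.[] = refl
splice-proj₂ (_ Hetero.∷ʳ m) = splice-proj₂ m
splice-proj₂ {b ∷ _} (_ Hetero.∷ m) = cong (proj₂ b ∷_) (splice-proj₂ m)

∈-splice⁻ : ∀ {w₁ w₂ p} (m : Matches w₁ w₂) → p ∈ splice m →
  ∃₂ λ a b → a ∈ w₂ × b ∈ w₁ × proj₂ a ≡ proj₁ b × p ≡ (proj₁ a , proj₂ b)
∈-splice⁻ (_ Hetero.∷ʳ m) p∈ with ∈-splice⁻ m p∈
... | a , b , a∈ , b∈ , ab , p≡ = a , b , there a∈ , b∈ , ab , p≡
∈-splice⁻ {b ∷ _} {a ∷ _} (ba Hetero.∷ m) (here refl) = a , b , here refl , here refl , sym ba , refl
∈-splice⁻ (_ Hetero.∷ m) (there p∈) with ∈-splice⁻ m p∈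
... | a , b , a∈ , b∈ , ab , p≡ = a , b , there a∈ , there b∈ , ab , p≡

occurrence-trans : ∀ {σ q p} → Occurrence σ q → Occurrence q p → Occurrence σ p
occurrence-trans (w₂ , w₂⊆σ , refl , concordant₂) (w₁ , w₁⊆q , refl , concordant₁) =
  splice m , ⊆-trans (splice-proj₁ m) w₂⊆σ , splice-proj₂ m , concordant
  where
  m : Matches w₁ w₂
  m = Hetero.map⁻ proj₁ proj₂ w₁⊆q
  concordant : Concordant (splice m)
  concordant x∈ y∈ with ∈-splice⁻ m x∈ | ∈-splice⁻ m y∈
  ... | a , b , a∈ , b∈ , ab , refl | a′ , b′ , a′∈ , b′∈ , a′b′ , refl =
    subst₂ (λ u v → (u ≤ v) ⇔ (proj₂ b ≤ proj₂ b′)) (sym ab) (sym a′b′) (concordant₁ b∈ b′∈)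
      ⇔-∘ concordant₂ a∈ a′∈

occurrence-standardize : ∀ {τ σ} → τ ⊆ σ → Occurrence σ (standardize τ)
occurrence-standardize {τ} {σ} τ⊆σ =
  map (λ x → x , rank τ x) τ ,
  subst (_⊆ σ) (sym (trans (sym (map-∘ τ)) (map-id τ))) τ⊆σ ,
  sym (map-∘ τ) ,
  concordant
  where
  concordant : Concordant (map (λ x → x , rank τ x) τ)
  concordant a∈ b∈ with ∈-map⁻ (λ x → x , rank τ x) a∈ | ∈-map⁻ (λ x → x , rank τ x) b∈
  ... | x , x∈τ , refl | y , y∈τ , refl = rank-order τ x∈τ y∈τ

occurrence-unstandardize : ∀ τ → Occurrence (standardize τ) τ
occurrence-unstandardize τ =
  map (λ x → rank τ x , x) τ ,
  ⊆-reflexive (sym (map-∘ τ)) ,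
  trans (sym (map-∘ τ)) (map-id τ) ,
  concordant
  where
  concordant : Concordant (map (λ x → rank τ x , x) τ)
  concordant a∈ b∈ with ∈-map⁻ (λ x → rank τ x , x) a∈ | ∈-map⁻ (λ x → rank τ x , x) b∈
  ... | x , x∈τ , refl | y , y∈τ , refl = ⇔-sym (rank-order τ x∈τ y∈τ)

-- Deletion and pruning

⊆-insert : ∀ {A : Set} (a : List A) x c → a ++ c ⊆ a ++ x ∷ c
⊆-insert a x c = ++⁺ ⊆-refl (x ∷ʳ ⊆-refl)

module _ (a : List ℕ) (w : ℕ) (c : List ℕ) where

  private
    ∈-insert : a ++ c ⊑ a ++ w ∷ c
    ∈-insert = Any-resp-⊆ (⊆-insert a w c)

  invShaped-delete : InvShaped (a ++ w ∷ c) → Staircase (rank (a ++ c)) (length a) c → InvShaped (a ++ c)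
  invShaped-delete shaped tail =
    staircase-++⁺ (rank (a ++ c)) 0 a
      (staircase-mono a (rank-⊑ ∈-insert) (proj₁ (staircase-++⁻ (rank (a ++ w ∷ c)) 0 a shaped)))
      tail

  invShaped-delete-slack : InvShaped (a ++ w ∷ c) → Staircase (rank (a ++ w ∷ c)) (length a) c →
    InvShaped (a ++ c)
  invShaped-delete-slack shaped slack = invShaped-delete shaped (staircase-mono c (rank-⊑ ∈-insert) slack)

  invShaped-delete-unique : InvShaped (a ++ w ∷ c) → w ∉ a ++ c → InvShaped (a ++ c)
  invShaped-delete-unique shaped w∉ = invShaped-delete shaped (staircase-lower c lower tail)
    where
    V = a ++ w ∷ c
    rankw≤ : rank V w ≤ length a
    rankw≤ = proj₁ (proj₂ (staircase-++⁻ (rank V) 0 a shaped))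
    tail : Staircase (rank V) (suc (length a)) c
    tail = proj₂ (proj₂ (staircase-++⁻ (rank V) 0 a shaped))
    lower : ∀ {y} → y ∈ c → rank (a ++ c) y ≤ length a ⊎ rank (a ++ c) y < rank V y
    lower {y} y∈c with <-cmp y w
    ... | tri< y<w _ _ =
      inj₁ (<⇒≤ (<-≤-trans (≤-<-trans (rank-⊑ ∈-insert y) (rank-< V (∈-++⁺ʳ a (there y∈c)) y<w)) rankw≤))
    ... | tri≈ _ refl _ = contradiction (∈-++⁺ʳ a y∈c) w∉
    ... | tri> _ _ w<y = inj₂ (rank-⊏ ∈-insert (∈-++⁺ʳ a (here refl)) w∉ w<y)

stuck-length-≤ : ∀ a w c A → (∀ m → m ∈ a ++ w ∷ c → m ∉ A → 2 ≤ multiplicity m (a ++ w ∷ c)) →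
  length c ≤ length A → ∀ {y} → y ∈ c → length a < rank (a ++ w ∷ c) y →
  length (a ++ w ∷ c) ≤ 3 * length A
stuck-length-≤ a w c A repeated c≤A {y} y∈c a<rank =
  subst (_≤ 3 * length A) (sym (length-++ a)) (arithmetic distinct-lower distinct-upper c≤A)
  where
  V = a ++ w ∷ c
  distinct-lower : 2 + length a ≤ rank V (suc y)
  distinct-lower = subst (2 + length a ≤_) (sym (rank-suc-∈ V (∈-++⁺ʳ a (there y∈c)))) (s≤s a<rank)
  distinct-upper : rank V (suc y) + rank V (suc y) ≤ (length a + suc (length c)) + length A
  distinct-upper = subst (λ n → rank V (suc y) + rank V (suc y) ≤ n + length A) (length-++ a)
    (twice-rank-≤ V A repeated (suc y))
  arithmetic : ∀ {i j k r} → 2 + i ≤ r → r + r ≤ (i + suc j) + k → j ≤ k → i + suc j ≤ 3 * k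
  arithmetic {i} {j} {k} {r} 2+i≤r r+r≤ j≤k = begin
    i + suc j         ≤⟨ ≤-trans (≤-reflexive (+-suc i j)) (m≤n+m (suc (i + j)) 2) ⟩
    (3 + i) + j       ≤⟨ +-monoˡ-≤ j 3+i≤j+k ⟩
    (j + k) + j       ≤⟨ +-mono-≤ (+-monoˡ-≤ k j≤k) j≤k ⟩
    (k + k) + k       ≡⟨ thrice k ⟩
    3 * k             ∎
    where
    open ≤-Reasoning
    thrice : ∀ k → (k + k) + k ≡ 3 * k
    thrice = solve-∀
    regroup : ∀ i → (2 + i) + (2 + i) ≡ i + (4 + i)
    regroup = solve-∀
    3+i≤j+k : 3 + i ≤ j + k
    3+i≤j+k = s≤s⁻¹ (+-cancelˡ-≤ i (4 + i) (suc j + k)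
      (subst₂ _≤_ (regroup i) (+-assoc i (suc j) k) (≤-trans (+-mono-≤ 2+i≤r 2+i≤r) r+r≤)))

-- Entries tagged true form the fixed occurrence of the pattern.
Marked : Set
Marked = List (ℕ × Bool)

values : Marked → List ℕ
values = map proj₁

marked : Marked → List ℕ
marked [] = []
marked ((v , true) ∷ τ) = v ∷ marked τ
marked ((v , false) ∷ τ) = marked τ

AllMarked : Marked → Set
AllMarked = All (λ e → proj₂ e ≡ true)

values-split : ∀ pre (e : ℕ × Bool) post → values (pre ++ e ∷ post) ≡ values pre ++ proj₁ e ∷ values post
values-split pre e post = map-++ proj₁ pre (e ∷ post)

marked-++ : ∀ τ υ → marked (τ ++ υ) ≡ marked τ ++ marked υ
marked-++ [] υ = refl
marked-++ ((v , true) ∷ τ) υ = cong (v ∷_) (marked-++ τ υ)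
marked-++ ((v , false) ∷ τ) υ = marked-++ τ υ

marked⊆values : ∀ τ → marked τ ⊆ values τ
marked⊆values [] = []
marked⊆values ((v , true) ∷ τ) = refl ∷ marked⊆values τ
marked⊆values ((v , false) ∷ τ) = v ∷ʳ marked⊆values τ

allMarked⇒length : ∀ {τ} → AllMarked τ → length τ ≡ length (marked τ)
allMarked⇒length [] = refl
allMarked⇒length {(v , true) ∷ τ} (refl ∷ allMarked) = cong suc (allMarked⇒length allMarked)

∈-unmarked : ∀ {m} τ → m ∈ values τ → m ∉ marked τ → (m , false) ∈ τ
∈-unmarked ((v , true) ∷ τ) (here refl) m∉ = contradiction (here refl) m∉
∈-unmarked ((v , false) ∷ τ) (here refl) _ = here refl
∈-unmarked ((v , true) ∷ τ) (there m∈) m∉ = there (∈-unmarked τ m∈ (m∉ ∘ there))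
∈-unmarked ((v , false) ∷ τ) (there m∈) m∉ = there (∈-unmarked τ m∈ m∉)

lastUnmarked : ∀ τ →
  AllMarked τ ⊎ ∃[ pre ] ∃[ w ] ∃[ post ] (τ ≡ pre ++ (w , false) ∷ post × AllMarked post)
lastUnmarked [] = inj₁ []
lastUnmarked (e ∷ τ) with lastUnmarked τ
... | inj₂ (pre , w , post , refl , allMarked) = inj₂ (e ∷ pre , w , post , refl , allMarked)
lastUnmarked ((v , true) ∷ τ) | inj₁ allMarked = inj₁ (refl ∷ allMarked)
lastUnmarked ((v , false) ∷ τ) | inj₁ allMarked = inj₂ ([] , v , τ , refl , allMarked)

mark : ∀ {A σ : List ℕ} → A ⊆ σ → Marked
mark [] = []
mark (y ∷ʳ A⊆σ) = (y , false) ∷ mark A⊆σ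
mark (_∷_ {x = x} _ A⊆σ) = (x , true) ∷ mark A⊆σ

values-mark : ∀ {A σ} (A⊆σ : A ⊆ σ) → values (mark A⊆σ) ≡ σ
values-mark [] = refl
values-mark (y ∷ʳ A⊆σ) = cong (y ∷_) (values-mark A⊆σ)
values-mark (refl ∷ A⊆σ) = cong (_ ∷_) (values-mark A⊆σ)

marked-mark : ∀ {A σ} (A⊆σ : A ⊆ σ) → marked (mark A⊆σ) ≡ A
marked-mark [] = refl
marked-mark (y ∷ʳ A⊆σ) = marked-mark A⊆σ
marked-mark (refl ∷ A⊆σ) = cong (_ ∷_) (marked-mark A⊆σ)

Pruning : Marked → Marked → Set
Pruning τ τ′ = InvShaped (values τ′) × marked τ′ ≡ marked τ × values τ′ ⊆ values τ

delete-unmarked : ∀ pre w post → InvShaped (values pre ++ values post) →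
  Pruning (pre ++ (w , false) ∷ post) (pre ++ post) × length (pre ++ post) < length (pre ++ (w , false) ∷ post)
delete-unmarked pre w post shaped =
  (subst InvShaped (sym (map-++ proj₁ pre post)) shaped ,
   trans (marked-++ pre post) (sym (marked-++ pre ((w , false) ∷ post))) ,
   Sublist.map⁺ proj₁ (⊆-insert pre (w , false) post)) ,
  ≤-reflexive (sym (length-++-sucʳ pre (w , false) post))

Shrinks : Marked → Set
Shrinks τ = ∃[ τ′ ] (Pruning τ τ′ × length τ′ < length τ)

Lonely : Marked → ℕ × Bool → Set
Lonely τ e = proj₂ e ≡ false × multiplicity (proj₁ e) (values τ) < 2

lonely? : ∀ τ e → Dec (Lonely τ e)
lonely? τ e = (proj₂ e Bool.≟ false) ×-dec (multiplicity (proj₁ e) (values τ) <? 2)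

prune-lonely : ∀ τ → InvShaped (values τ) → ∀ {e} → e ∈ τ → Lonely τ e → Shrinks τ
prune-lonely τ shaped {w , .false} e∈τ (refl , lonely) with ∈-∃++ e∈τ
... | pre , post , refl =
  pre ++ post ,
  delete-unmarked pre w post
    (invShaped-delete-unique (values pre) w (values post)
      (subst InvShaped (values-split pre (w , false) post) shaped) w∉)
  where
  w∉ : w ∉ values pre ++ values post
  w∉ w∈ = <⇒≱ (subst (λ V → multiplicity w V < 2) (values-split pre (w , false) post) lonely)
    (subst (2 ≤_) (sym (multiplicity-insert w (values pre) (values post))) (s≤s (∈⇒multiplicity-pos w∈)))

lonelyFree⇒repeated : ∀ τ → ¬ Any (Lonely τ) τ →
  ∀ m → m ∈ values τ → m ∉ marked τ → 2 ≤ multiplicity m (values τ)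
lonelyFree⇒repeated τ none m m∈ m∉ =
  ≮⇒≥ (λ lonely → All.lookup (¬Any⇒All¬ τ none) (∈-unmarked τ m∈ m∉) (refl , lonely))

module _ (pre : Marked) (w : ℕ) (post : Marked) where

  private
    τ : Marked
    τ = pre ++ (w , false) ∷ post
    V : List ℕ
    V = values pre ++ w ∷ values post
    split : values τ ≡ V
    split = values-split pre (w , false) post

    post≤marked : AllMarked post → length (values post) ≤ length (marked τ)
    post≤marked postMarked = begin
      length (values post)                       ≡⟨ length-map proj₁ post ⟩
      length post                                ≡⟨ allMarked⇒length postMarked ⟩
      length (marked post)                       ≤⟨ m≤n+m (length (marked post)) (length (marked pre)) ⟩
      length (marked pre) + length (marked post) ≡⟨ length-++ (marked pre) ⟨
      length (marked pre ++ marked post)         ≡⟨ cong length (marked-++ pre ((w , false) ∷ post)) ⟨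
      length (marked τ)                          ∎
      where open ≤-Reasoning

  prune-last : InvShaped (values τ) → (∀ m → m ∈ values τ → m ∉ marked τ → 2 ≤ multiplicity m (values τ)) →
    AllMarked post → Shrinks τ ⊎ length τ ≤ 3 * length (marked τ)
  prune-last shaped repeated postMarked with staircase-or-violation (rank V) (length (values pre)) (values post)
  ... | inj₁ slack =
    inj₁ (pre ++ post , delete-unmarked pre w post
      (invShaped-delete-slack (values pre) w (values post) (subst InvShaped split shaped) slack))
  ... | inj₂ (y , y∈post , tight) =
    inj₂ (subst (_≤ 3 * length (marked τ)) (trans (cong length (sym split)) (length-map proj₁ τ))
      (stuck-length-≤ (values pre) w (values post) (marked τ)
        (subst (λ U → ∀ m → m ∈ U → m ∉ marked τ → 2 ≤ multiplicity m U) split repeated)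
        (post≤marked postMarked) y∈post tight))

prune-step : ∀ τ → InvShaped (values τ) → Shrinks τ ⊎ length τ ≤ 3 * length (marked τ)
prune-step τ shaped with any? (lonely? τ) τ
... | yes someLonely = let e , e∈τ , lonely = find someLonely in inj₁ (prune-lonely τ shaped e∈τ lonely)
... | no noneLonely with lastUnmarked τ
...   | inj₁ allMarked = inj₂ (≤-trans (≤-reflexive (allMarked⇒length allMarked)) (m≤n*m _ 3))
...   | inj₂ (pre , w , post , refl , postMarked) =
  prune-last pre w post shaped (lonelyFree⇒repeated τ noneLonely) postMarked

prune : ∀ τ → InvShaped (values τ) → ∃[ τ′ ] (Pruning τ τ′ × length τ′ ≤ 3 * length (marked τ))
prune τ = go τ (<-wellFounded (length τ))
  where
  go : ∀ τ → Acc _<_ (length τ) → InvShaped (values τ) →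
    ∃[ τ′ ] (Pruning τ τ′ × length τ′ ≤ 3 * length (marked τ))
  go τ (acc smaller) shaped with prune-step τ shaped
  ... | inj₂ short = τ , (shaped , refl , ⊆-refl) , short
  ... | inj₁ (τ′ , (shaped′ , marks , τ′⊆τ) , shorter) with go τ′ (smaller shorter) shaped′
  ...   | τ″ , (shaped″ , marks′ , τ″⊆τ′) , bound =
    τ″ , (shaped″ , trans marks′ marks , ⊆-trans τ″⊆τ′ τ′⊆τ) ,
    subst (λ A → length τ″ ≤ 3 * length A) marks bound

-- A short Cayley inversion sequence between p and σ

occurrence-nonempty : ∀ {σ ρ} → ρ ≢ [] → Occurrence σ ρ → σ ≢ []
occurrence-nonempty ρ≢[] ([] , _ , refl , _) = contradiction refl ρ≢[]
occurrence-nonempty _ (_ ∷ _ , () , _) refl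

invShaped-witness : ∀ {σ p} → IsInvSeq σ → Contains σ p →
  ∃[ V ] (V ⊆ σ × InvShaped V × Occurrence V p × length V ≤ 3 * length p)
invShaped-witness inv σ⊇p with contains⇒occurrence σ⊇p
... | w , A⊆σ , refl , concordant
  with prune (mark A⊆σ) (subst InvShaped (sym (values-mark A⊆σ)) (isInvSeq⇒invShaped inv))
...   | τ , (shaped , marks , τ⊆) , bound =
  values τ ,
  subst (values τ ⊆_) (values-mark A⊆σ) τ⊆ ,
  shaped ,
  (w , subst (_⊆ values τ) (trans marks (marked-mark A⊆σ)) (marked⊆values τ) , refl , concordant) ,
  subst₂ (λ n m → n ≤ 3 * m) (sym (length-map proj₁ τ)) markedLength bound
  where
  markedLength : length (marked (mark A⊆σ)) ≡ length (map proj₂ w)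
  markedLength = trans (cong length (marked-mark A⊆σ)) (trans (length-map proj₁ w) (sym (length-map proj₂ w)))

invCayley-witness : ∀ {σ p} → IsInvSeq σ → Contains σ p →
  ∃[ q ] (IsInvSeq q × IsCayley q × Contains σ q × Contains q p × length q ≤ 3 * length p)
invCayley-witness inv σ⊇p@(p≢[] , _) with invShaped-witness inv σ⊇p
... | V , V⊆σ , shaped , V⊇p , bound =
  standardize V ,
  invShaped⇒isInvSeq shaped ,
  cayley ,
  occurrence⇒contains (proj₁ cayley) (occurrence-standardize V⊆σ) ,
  occurrence⇒contains p≢[] (occurrence-trans (occurrence-unstandardize V) V⊇p) ,
  subst (_≤ _) (sym (length-map (rank V) V)) bound
  where
  cayley : IsCayley (standardize V)
  cayley = standardize-isCayley (occurrence-nonempty p≢[] V⊇p)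

contains-trans : ∀ {σ q p} → Contains σ q → Contains q p → Contains σ p
contains-trans σ⊇q q⊇p@(p≢[] , _) =
  occurrence⇒contains p≢[] (occurrence-trans (contains⇒occurrence σ⊇q) (contains⇒occurrence q⊇p))

-- The finite candidate set

listsBelow : ℕ → ℕ → List (List ℕ)
listsBelow b zero = [ [] ]
listsBelow b (suc n) = [] ∷ concatMap (λ x → map (x ∷_) (listsBelow b n)) (upTo b)

∈-listsBelow : ∀ {b n l} → length l ≤ n → All (_< b) l → l ∈ listsBelow b n
∈-listsBelow {n = zero} {[]} _ _ = here refl
∈-listsBelow {n = suc n} {[]} _ _ = here refl
∈-listsBelow {b} {suc n} {x ∷ l} (s≤s l≤n) (x<b ∷ l<b) =
  there (∈-concatMap⁺ (λ y → map (y ∷_) (listsBelow b n))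
    (Any.map (λ { refl → ∈-map⁺ (x ∷_) (∈-listsBelow l≤n l<b) }) (∈-upTo⁺ x<b)))

module _ {A : Set} where

  sublists : List A → List (List A)
  sublists [] = [ [] ]
  sublists (x ∷ l) = map (x ∷_) (sublists l) ++ sublists l

  ∈-sublists⁺ : ∀ {τ l} → τ ⊆ l → τ ∈ sublists l
  ∈-sublists⁺ [] = here refl
  ∈-sublists⁺ {l = x ∷ l} (x ∷ʳ τ⊆l) = ∈-++⁺ʳ (map (x ∷_) (sublists l)) (∈-sublists⁺ τ⊆l)
  ∈-sublists⁺ {l = x ∷ l} (refl ∷ τ⊆l) = ∈-++⁺ˡ (∈-map⁺ (x ∷_) (∈-sublists⁺ τ⊆l))

  ∈-sublists⁻ : ∀ {τ} l → τ ∈ sublists l → τ ⊆ l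
  ∈-sublists⁻ [] (here refl) = []
  ∈-sublists⁻ (x ∷ l) τ∈ with ∈-++⁻ (map (x ∷_) (sublists l)) τ∈
  ... | inj₂ τ∈rest = x ∷ʳ ∈-sublists⁻ l τ∈rest
  ... | inj₁ τ∈cons with ∈-map⁻ (x ∷_) τ∈cons
  ...   | τ′ , τ′∈ , refl = refl ∷ ∈-sublists⁻ l τ′∈

_⇔?_ : ∀ {A B : Set} → Dec A → Dec B → Dec (A ⇔ B)
a? ⇔? b? = Dec.map′ (λ (to , from) → mk⇔ to from) (λ a⇔b → Equivalence.to a⇔b , Equivalence.from a⇔b)
  ((a? →-dec b?) ×-dec (b? →-dec a?))

orderIso? : ∀ τ ρ → Dec (OrderIso τ ρ)
orderIso? τ ρ with length τ ≟ length ρ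
... | no ≢ = no (≢ ∘ proj₁)
... | yes eq = Dec.map′ (eq ,_) proj₂
  (Fin.all? λ i → Fin.all? λ j → (lookup τ i ≤? lookup τ j) ⇔? (lookup ρ (cast eq i) ≤? lookup ρ (cast eq j)))

contains? : ∀ σ ρ → Dec (Contains σ ρ)
contains? σ ρ = Dec.map′ fromSublists toSublists
  (¬? (≡-dec _≟_ ρ []) ×-dec any? (λ τ → orderIso? τ ρ) (sublists σ))
  where
  fromSublists : ρ ≢ [] × Any (λ τ → OrderIso τ ρ) (sublists σ) → Contains σ ρ
  fromSublists (ρ≢[] , some) = let τ , τ∈ , iso = find some in ρ≢[] , τ , ∈-sublists⁻ σ τ∈ , iso
  toSublists : Contains σ ρ → ρ ≢ [] × Any (λ τ → OrderIso τ ρ) (sublists σ)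
  toSublists (ρ≢[] , τ , τ⊆σ , iso) = ρ≢[] , Any.map (λ { refl → iso }) (∈-sublists⁺ τ⊆σ)

isInvSeq? : ∀ q → Dec (IsInvSeq q)
isInvSeq? q = Fin.all? (λ j → lookup q j ≤? toℕ j)

isInvSeq⇒entries< : ∀ {q} → IsInvSeq q → All (_< length q) q
isInvSeq⇒entries< {q} inv = All.tabulate λ x∈q →
  subst (_< length q) (sym (lookup-index x∈q)) (≤-<-trans (inv (Any.index x∈q)) (toℕ<n (Any.index x∈q)))

isInvSeq⇒∈listsBelow : ∀ {q N} → IsInvSeq q → length q ≤ N → q ∈ listsBelow N N
isInvSeq⇒∈listsBelow inv q≤N = ∈-listsBelow q≤N (All.map (λ x< → <-≤-trans x< q≤N) (isInvSeq⇒entries< inv))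

∈⇒≤sum : ∀ {x xs} → x ∈ xs → x ≤ sum xs
∈⇒≤sum {xs = y ∷ xs} (here refl) = m≤m+n y (sum xs)
∈⇒≤sum {xs = y ∷ xs} (there x∈) = ≤-trans (∈⇒≤sum x∈) (m≤n+m (sum xs) y)

Good : List Seq → Seq → Set
Good P q = IsInvSeq q × IsCayley q × Any (Contains q) P

good? : ∀ P q → Dec (Good P q)
good? P q = isInvSeq? q ×-dec isCayley? q ×-dec any? (contains? q) P

theorem3p5 : (P : List Seq) → All (λ p → p ≢ [] × IsCayley p) P →
    ∃[ Q ] (All (λ q → IsInvSeq q × IsCayley q) Q ×
      ((σ : Seq) → IsInvSeq σ → (AvoidsAll P σ ⇔ AvoidsAll Q σ)))
theorem3p5 P _ =
  Q , All.map (λ (inv , cayley , _) → inv , cayley) allGood ,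
  λ σ inv → mk⇔ (avoidsP⇒avoidsQ σ) (avoidsQ⇒avoidsP σ inv)
  where
  N = 3 * sum (map length P)
  candidates = listsBelow N N
  Q = filter (good? P) candidates
  allGood : All (Good P) Q
  allGood = all-filter (good? P) candidates

  avoidsP⇒avoidsQ : ∀ σ → AvoidsAll P σ → AvoidsAll Q σ
  avoidsP⇒avoidsQ σ avoidsP = All.tabulate λ q∈Q σ⊇q →
    let (_ , _ , q⊇someP) = All.lookup allGood q∈Q
    in All¬⇒¬Any avoidsP (Any.map (contains-trans σ⊇q) q⊇someP)

  avoidsQ⇒avoidsP : ∀ σ → IsInvSeq σ → AvoidsAll Q σ → AvoidsAll P σ
  avoidsQ⇒avoidsP σ inv avoidsQ = All.tabulate λ p∈P σ⊇p →
    let (q , q-inv , q-cayley , σ⊇q , q⊇p , q-short) = invCayley-witness inv σ⊇p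
        q≤N = ≤-trans q-short (*-monoʳ-≤ 3 (∈⇒≤sum (∈-map⁺ length p∈P)))
        q∈Q = ∈-filter⁺ (good? P) (isInvSeq⇒∈listsBelow q-inv q≤N)
                (q-inv , q-cayley , Any.map (λ { refl → q⊇p }) p∈P)
    in All.lookup avoidsQ q∈Q σ⊇q
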